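{- The relation $\leadsto$ on acceleration problems preserves consistency: if $P$ is a consistent acceleration problem and $P\leadsto Q$, then $Q$ is consistent. The relation $\leadsto_e$ preserves exactness: if $P$ is an exact acceleration problem and $P\leadsto_e Q$, then $Q$ is exact.
   Context: Fix $d\ge 1$, integer variables $\vec x=(x_1,\dots,x_d)$, $\vec x'$, and $n$ ranging over $\mathbb N$; $\vec y=(\vec x,n,\vec x')$. A loop $\langle\phi,\vec a\rangle$ consists of a quantifier-free formula $\phi$ over atoms $p>0$ ($p$ an arithmetic expression over $\vec x$, integer semantics) and a map $\vec a:\mathbb Z^d\to\mathbb Z^d$ given by expressions over $\vec x$; $\vec a^m$ is $m$-fold application. $\vec x\longrightarrow_{\langle\phi,\vec a\rangle}\vec x'$ iff $\phi(\vec x)\land\vec x'=\vec a(\vec x)$, and $\longrightarrow^m$ is its $m$-fold composition. A formula $\psi$ over $\vec y$ approximates $\langle\phi,\vec a\rangle$ if for all $\vec x,\vec x'\in\mathbb Z^d$, $n>0$, $\psi$ implies $\vec x\longrightarrow^n_{\langle\phi,\vec a\rangle}\vec x'$, and is equivalent to it if moreover the converse holds. A conditional acceleration technique is a partial function $\mathit{accel}$ from pairs (loop $\langle\chi,\vec a\rangle$, quantifier-free formula $\check\phi$ over $\vec x$) to formulas over $\vec y$; it is sound if for all arguments in its domain, all $\vec x,\vec x'$ and $n>0$, $\vec x\longrightarrow^n_{\langle\check\phi,\vec a\rangle}\vec x'\land\mathit{accel}(\langle\chi,\vec a\rangle,\check\phi)$ implies $\vec x\longrightarrow^n_{\langle\chi,\vec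 a\rangle}\vec x'$; it is exact if it is sound and $\vec x\longrightarrow^n_{\langle\chi\land\check\phi,\vec a\rangle}\vec x'$ implies $\mathit{accel}(\langle\chi,\vec a\rangle,\check\phi)$. Formulas are in CNF and identified with their sets of clauses. An acceleration problem is a tuple $[\![\psi\mid\check\phi\mid\hat\phi]\!]_{\vec a}$ with $\psi$ a formula over $\vec y$, $\check\phi,\hat\phi$ quantifier-free formulas over $\vec x$, and $\vec a:\mathbb Z^d\to\mathbb Z^d$; it is consistent if $\psi$ approximates $\langle\check\phi,\vec a\rangle$ and exact if $\psi$ is equivalent to $\langle\check\phi,\vec a\rangle$. The relation $\leadsto$ is defined by: $[\![\psi_1\mid\check\phi\mid\hat\phi]\!]_{\vec a}\leadsto[\![\psi_1\cup\psi_2\mid\check\phi\cup\chi\mid\hat\phi\setminus\chi]\!]_{\vec a}$ whenever $\emptyset\ne\chi\subseteq\hat\phi$ (as sets of clauses) and $\mathit{accel}(\langle\chi,\vec a\rangle,\check\phi)=\psi_2$ for some sound conditional acceleration technique $\mathit{accel}$; such a step is a $\leadsto_e$-step if $\mathit{accel}$ is exact. -}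

module Defs where

open import Data.Nat using (ℕ; zero; suc)
import Data.Nat as ℕ
open import Data.Integer using (ℤ; +_; _+_; _*_; -_; _<_)
open import Data.Fin using (Fin)
open import Data.Vec using (Vec; lookup; tabulate)
open import Data.List using (List; _++_)
open import Data.List.Relation.Unary.All using (All)
open import Data.List.Relation.Unary.Any using (Any)
open import Data.List.Membership.Propositional using (_∈_; _∉_)
open import Data.List.Relation.Binary.Subset.Propositional using (_⊆_)
open import Data.Maybe using (Maybe; just)
open import Data.Product using (Σ; _×_; ∃)
open import Relation.Binary.PropositionalEquality using (_≡_)
open import Relation.Nullary using (¬_)

data Expr (V : Set) : Set where
  con  : ℤ → Expr V
  var  : V → Expr V
  _⊕_  : Expr V → Expr V → Expr V
  _⊗_  : Expr V → Expr V → Expr V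
  ⊖_   : Expr V → Expr V

eval : {V : Set} → (V → ℤ) → Expr V → ℤ
eval ρ (con c)  = c
eval ρ (var v)  = ρ v
eval ρ (e ⊕ f)  = eval ρ e + eval ρ f
eval ρ (e ⊗ f)  = eval ρ e * eval ρ f
eval ρ (⊖ e)    = - eval ρ e

-- an atom  p > 0  is represented by the expression p
Atom : Set → Set
Atom V = Expr V

Clause : Set → Set
Clause V = List (Atom V)

CNF : Set → Set
CNF V = List (Clause V)

⟦_⟧ : {V : Set} → CNF V → (V → ℤ) → Set
⟦ φ ⟧ ρ = All (λ cl → Any (λ p → + 0 < eval ρ p) cl) φ

data YVar (d : ℕ) : Set where
  xv  : Fin d → YVar d
  nv  : YVar d
  x'v : Fin d → YVar d

yval : {d : ℕ} → Vec ℤ d → ℕ → Vec ℤ d → YVar d → ℤ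
yval x n x' (xv i)  = lookup x i
yval x n x' nv      = + n
yval x n x' (x'v i) = lookup x' i

holdsX : {d : ℕ} → CNF (Fin d) → Vec ℤ d → Set
holdsX φ x = ⟦ φ ⟧ (lookup x)

holdsY : {d : ℕ} → CNF (YVar d) → Vec ℤ d → ℕ → Vec ℤ d → Set
holdsY ψ x n x' = ⟦ ψ ⟧ (yval x n x')

Update : ℕ → Set
Update d = Fin d → Expr (Fin d)

apply : {d : ℕ} → Update d → Vec ℤ d → Vec ℤ d
apply a x = tabulate (λ i → eval (lookup x) (a i))

record Loop (d : ℕ) : Set where
  constructor ⟨_,_⟩
  field
    guard  : CNF (Fin d)
    update : Update d

Step : {d : ℕ} → CNF (Fin d) → Update d → Vec ℤ d → Vec ℤ d → Set
Step φ a x x' = holdsX φ x × (x' ≡ apply a x)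

data Steps {d : ℕ} (φ : CNF (Fin d)) (a : Update d) : ℕ → Vec ℤ d → Vec ℤ d → Set where
  done : ∀ {x} → Steps φ a zero x x
  next : ∀ {m x z x'} → Step φ a x z → Steps φ a m z x' → Steps φ a (suc m) x x'

Approximates : {d : ℕ} → CNF (YVar d) → Loop d → Set
Approximates {d} ψ ⟨ φ , a ⟩ =
  (x x' : Vec ℤ d) (n : ℕ) → 0 ℕ.< n → holdsY ψ x n x' → Steps φ a n x x'

Equivalent : {d : ℕ} → CNF (YVar d) → Loop d → Set
Equivalent {d} ψ ⟨ φ , a ⟩ =
  Approximates ψ ⟨ φ , a ⟩ ×
  ((x x' : Vec ℤ d) (n : ℕ) → 0 ℕ.< n → Steps φ a n x x' → holdsY ψ x n x')

AccelTechnique : ℕ → Set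
AccelTechnique d = Loop d → CNF (Fin d) → Maybe (CNF (YVar d))

SoundAccel : {d : ℕ} → AccelTechnique d → Set
SoundAccel {d} accel =
  ∀ (χ : CNF (Fin d)) (a : Update d) (φ̌ : CNF (Fin d)) (ψ : CNF (YVar d)) →
  accel ⟨ χ , a ⟩ φ̌ ≡ just ψ →
  (x x' : Vec ℤ d) (n : ℕ) → 0 ℕ.< n →
  Steps φ̌ a n x x' → holdsY ψ x n x' → Steps χ a n x x'

ExactAccel : {d : ℕ} → AccelTechnique d → Set
ExactAccel {d} accel =
  SoundAccel accel ×
  (∀ (χ : CNF (Fin d)) (a : Update d) (φ̌ : CNF (Fin d)) (ψ : CNF (YVar d)) →
   accel ⟨ χ , a ⟩ φ̌ ≡ just ψ →
   (x x' : Vec ℤ d) (n : ℕ) → 0 ℕ.< n →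
   Steps (χ ++ φ̌) a n x x' → holdsY ψ x n x')

record AccelProblem (d : ℕ) : Set where
  constructor ⟦_∣_∣_⟧[_]
  field
    ψ  : CNF (YVar d)
    φ̌  : CNF (Fin d)
    φ̂  : CNF (Fin d)
    a  : Update d

Consistent : {d : ℕ} → AccelProblem d → Set
Consistent P = Approximates (AccelProblem.ψ P) ⟨ AccelProblem.φ̌ P , AccelProblem.a P ⟩

ExactProblem : {d : ℕ} → AccelProblem d → Set
ExactProblem P = Equivalent (AccelProblem.ψ P) ⟨ AccelProblem.φ̌ P , AccelProblem.a P ⟩

IsDiff : {V : Set} → CNF V → CNF V → CNF V → Set
IsDiff φ̂ χ ρ = ∀ c → (c ∈ ρ → c ∈ φ̂ × c ∉ χ) × (c ∈ φ̂ × c ∉ χ → c ∈ ρ)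

NonEmpty : {V : Set} → CNF V → Set
NonEmpty χ = ∃ λ c → c ∈ χ

StepWith : {d : ℕ} → AccelTechnique d → AccelProblem d → AccelProblem d → Set
StepWith {d} accel P Q =
  Σ (CNF (Fin d)) λ χ → Σ (CNF (YVar d)) λ ψ₂ →
    NonEmpty χ × χ ⊆ φ̂ P ×
    accel ⟨ χ , a P ⟩ (φ̌ P) ≡ just ψ₂ ×
    ψ Q ≡ ψ P ++ ψ₂ × φ̌ Q ≡ φ̌ P ++ χ × IsDiff (φ̂ P) χ (φ̂ Q) × a Q ≡ a P
  where open AccelProblem

_↝_ : {d : ℕ} → AccelProblem d → AccelProblem d → Set
_↝_ {d} P Q = Σ (AccelTechnique d) λ accel → SoundAccel accel × StepWith accel P Q

_↝ₑ_ : {d : ℕ} → AccelProblem d → AccelProblem d → Set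
_↝ₑ_ {d} P Q = Σ (AccelTechnique d) λ accel → ExactAccel accel × StepWith accel P Q

{-# OPTIONS --safe #-}
module Submission where

-- An n-step run satisfying ψ ∧ ψ₂ is a run under φ̌ by consistency of P, and soundness of
-- the technique upgrades it to a run under χ as well, i.e. under φ̌ ∧ χ. Conversely a run
-- under φ̌ ∧ χ yields ψ by exactness of P and ψ₂ by exactness of the technique.

open import Defs
open import Data.Nat using (ℕ; _≤_)
open import Data.Product using (_×_; _,_)
open import Data.Fin using (Fin)
open import Data.List using (_++_)
open import Data.List.Relation.Unary.All.Properties using (++⁺; ++⁻ˡ; ++⁻ʳ)
open import Relation.Binary.PropositionalEquality using (refl)

module _ {d : ℕ} {a : Update d} where

  Steps-map : {φ φ' : CNF (Fin d)} → (∀ x → holdsX φ x → holdsX φ' x) →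
              ∀ {n x x'} → Steps φ a n x x' → Steps φ' a n x x'
  Steps-map f done = done
  Steps-map f (next {x = x} (h , e) r) = next (f x h , e) (Steps-map f r)

  Steps-++⁺ : {φ χ : CNF (Fin d)} →
              ∀ {n x x'} → Steps φ a n x x' → Steps χ a n x x' → Steps (φ ++ χ) a n x x'
  Steps-++⁺ done done = done
  Steps-++⁺ (next (h , refl) r) (next (h' , refl) r') = next (++⁺ h h' , refl) (Steps-++⁺ r r')

  Steps-++⁻ˡ : (φ : CNF (Fin d)) {χ : CNF (Fin d)} →
               ∀ {n x x'} → Steps (φ ++ χ) a n x x' → Steps φ a n x x'
  Steps-++⁻ˡ φ = Steps-map (λ _ → ++⁻ˡ φ)

  Steps-++⁻ʳ : (φ : CNF (Fin d)) {χ : CNF (Fin d)} →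
               ∀ {n x x'} → Steps (φ ++ χ) a n x x' → Steps χ a n x x'
  Steps-++⁻ʳ φ = Steps-map (λ _ → ++⁻ʳ φ)

  Steps-++-comm : (φ : CNF (Fin d)) {χ : CNF (Fin d)} →
                  ∀ {n x x'} → Steps (φ ++ χ) a n x x' → Steps (χ ++ φ) a n x x'
  Steps-++-comm φ s = Steps-++⁺ (Steps-++⁻ʳ φ s) (Steps-++⁻ˡ φ s)

module _ {d : ℕ} {accel : AccelTechnique d} where

  StepWith-preserves-Consistent : SoundAccel accel → {P Q : AccelProblem d} →
                                  StepWith accel P Q → Consistent P → Consistent Q
  StepWith-preserves-Consistent sound
    {⟦ ψ ∣ φ̌ ∣ _ ⟧[ a ]} (χ , ψ₂ , _ , _ , accel≡ψ₂ , refl , refl , _ , refl) approx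
    x x' n n>0 holds = Steps-++⁺ s (sound χ a φ̌ ψ₂ accel≡ψ₂ x x' n n>0 s (++⁻ʳ ψ holds))
    where s = approx x x' n n>0 (++⁻ˡ ψ holds)

  StepWith-preserves-ExactProblem : ExactAccel accel → {P Q : AccelProblem d} →
                                    StepWith accel P Q → ExactProblem P → ExactProblem Q
  StepWith-preserves-ExactProblem (sound , complete)
    {P@(⟦ ψ ∣ φ̌ ∣ _ ⟧[ a ])} step@(χ , ψ₂ , _ , _ , accel≡ψ₂ , refl , refl , _ , refl)
    (approx , conv) =
      StepWith-preserves-Consistent sound {P} step approx ,
      λ x x' n n>0 s →
        ++⁺ (conv x x' n n>0 (Steps-++⁻ˡ φ̌ s))
            (complete χ a φ̌ ψ₂ accel≡ψ₂ x x' n n>0 (Steps-++-comm φ̌ s))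

lemma2 : (d : ℕ) → 1 ≤ d →
    ((P Q : AccelProblem d) → Consistent P → P ↝ Q → Consistent Q) ×
    ((P Q : AccelProblem d) → ExactProblem P → P ↝ₑ Q → ExactProblem Q)
lemma2 d _ =
  (λ P Q approx (_ , sound , step) → StepWith-preserves-Consistent sound {P} {Q} step approx) ,
  (λ P Q exact (_ , exactAccel , step) → StepWith-preserves-ExactProblem exactAccel {P} {Q} step exact)
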